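{- Let $S$ and $T$ be two disjoint non-empty sets of points in $\mathbb{R}^d$ with $|S|+|T|=d+2$ and $S\cup T$ in general position. Then $\operatorname{conv}(S)\cap\operatorname{aff}(T)\neq\emptyset$ if and only if all points of $S$ lie in the same part of the Radon partition of $S\cup T$.
   Context: For $d+2$ points in general position in $\mathbb{R}^d$, the Radon partition is the unique partition of the points into two sets $A,B$ with $\operatorname{conv}(A)\cap\operatorname{conv}(B)\neq\emptyset$. $\operatorname{aff}$ denotes affine hull. -}

module Defs where

open import Level using (Level; _⊔_) renaming (suc to lsuc)
open import Data.Nat using (ℕ; zero; suc) renaming (_≤_ to _≤ℕ_)
open import Data.Fin using (Fin; zero; suc)
open import Data.Fin.Subset using (Subset; _∈_; _∉_; ∣_∣)
open import Data.Product using (∃; _×_; _,_)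
open import Relation.Nullary using (¬_)
open import Relation.Binary.PropositionalEquality using (_≡_)
open import Relation.Binary.Structures using (IsTotalOrder)
open import Algebra.Bundles using (CommutativeRing)

-- A Dedekind-complete ordered field (i.e. the real numbers, up to isomorphism).
record CompleteOrderedField c ℓ : Set (lsuc (c ⊔ ℓ)) where
  field
    commutativeRing : CommutativeRing c ℓ
  open CommutativeRing commutativeRing public
  infix 4 _≤ᶠ_
  field
    _≤ᶠ_          : Carrier → Carrier → Set ℓ
    ≤-isTotalOrder : IsTotalOrder _≈_ _≤ᶠ_
    0≉1           : ¬ (0# ≈ 1#)
    +-mono-≤      : ∀ {x y} z → x ≤ᶠ y → (x + z) ≤ᶠ (y + z)
    *-nonneg      : ∀ {x y} → 0# ≤ᶠ x → 0# ≤ᶠ y → 0# ≤ᶠ (x * y)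
    inverse       : ∀ x → ¬ (x ≈ 0#) → ∃ λ y → (x * y) ≈ 1#
    complete      : (P : Carrier → Set ℓ) → ∃ P →
                    (∃ λ b → ∀ x → P x → x ≤ᶠ b) →
                    ∃ λ s → (∀ x → P x → x ≤ᶠ s) ×
                            (∀ b → (∀ x → P x → x ≤ᶠ b) → s ≤ᶠ b)

module _ {c ℓ} (R : CompleteOrderedField c ℓ) where
  open CompleteOrderedField R using (Carrier; _≈_; _+_; _*_; 0#; 1#; _≤ᶠ_)

  Point : ℕ → Set c
  Point d = Fin d → Carrier

  sumF : ∀ {n} → (Fin n → Carrier) → Carrier
  sumF {zero}  f = 0#
  sumF {suc n} f = f zero + sumF (λ i → f (suc i))

  InAff : ∀ {d m} → (Fin m → Point d) → Subset m → Point d → Set (c ⊔ ℓ)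
  InAff {d} {m} p A x = ∃ λ (w : Fin m → Carrier) →
    (∀ i → i ∉ A → w i ≈ 0#) × (sumF w ≈ 1#) ×
    (∀ (k : Fin d) → sumF (λ i → w i * p i k) ≈ x k)

  InConv : ∀ {d m} → (Fin m → Point d) → Subset m → Point d → Set (c ⊔ ℓ)
  InConv {d} {m} p A x = ∃ λ (w : Fin m → Carrier) →
    (∀ i → 0# ≤ᶠ w i) × (∀ i → i ∉ A → w i ≈ 0#) × (sumF w ≈ 1#) ×
    (∀ (k : Fin d) → sumF (λ i → w i * p i k) ≈ x k)

  AffinelyIndependent : ∀ {d m} → (Fin m → Point d) → Subset m → Set (c ⊔ ℓ)
  AffinelyIndependent {d} {m} p A = ∀ (w : Fin m → Carrier) →
    (∀ i → i ∉ A → w i ≈ 0#) → sumF w ≈ 0# →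
    (∀ (k : Fin d) → sumF (λ i → w i * p i k) ≈ 0#) →
    ∀ i → w i ≈ 0#

  Distinct : ∀ {d m} → (Fin m → Point d) → Set ℓ
  Distinct {d} p = ∀ i j → (∀ (k : Fin d) → p i k ≈ p j k) → i ≡ j

  GeneralPosition : ∀ {d m} → (Fin m → Point d) → Set (c ⊔ ℓ)
  GeneralPosition {d} {m} p = ∀ (A : Subset m) → ∣ A ∣ ≤ℕ suc d → AffinelyIndependent p A

  ConvMeetsAff : ∀ {d m} → (Fin m → Point d) → Subset m → Subset m → Set (c ⊔ ℓ)
  ConvMeetsAff {d} p A B = ∃ λ (x : Point d) → InConv p A x × InAff p B x

  ConvMeetsConv : ∀ {d m} → (Fin m → Point d) → Subset m → Subset m → Set (c ⊔ ℓ)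
  ConvMeetsConv {d} p A B = ∃ λ (x : Point d) → InConv p A x × InConv p B x

-- Affine dependences ∑ μᵢ pᵢ = 0, ∑ μᵢ = 0 of d + 2 points in general position form a
-- line, and a nonzero one vanishes nowhere (otherwise d + 1 of the points would be
-- dependent). The Radon partition is the sign pattern of this dependence μ. A point of
-- conv(S) ∩ aff(T) yields a second dependence that is nonnegative on S; being a multiple
-- of μ, it forces μ to have constant sign on S. Conversely, if μ ≥ 0 on S, splitting
-- ∑ μᵢ pᵢ = 0 into its S-part and T-part and normalising exhibits a common point.
module Submission where

open import Defs
open import Data.Nat using (ℕ; suc; zero; _∸_) renaming (_≤_ to _≤ℕ_)
import Data.Nat.Properties as ℕₚ
open import Data.Fin using (Fin; zero; suc)
open import Data.Fin.Subset using (Subset; ∁; Nonempty; _⊆_; _∈_; _∉_; ∣_∣; ⁅_⁆)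
open import Data.Fin.Subset.Properties
  using (_∈?_; x∈⁅y⁆⇒x≡y; x∈p⇒x∉∁p; x∉p⇒x∈∁p; x∈∁p⇒x∉p; x∉∁p⇒x∈p;
         ∣∁p∣≡n∸∣p∣; ∣⁅x⁆∣≡1)
open import Data.Sum using (_⊎_; inj₁; inj₂)
open import Data.Product using (∃; _×_; _,_; proj₁; proj₂)
open import Data.Empty using (⊥; ⊥-elim)
open import Level using (_⊔_)
open import Relation.Nullary using (¬_; yes; no)
import Relation.Binary.PropositionalEquality as ≡
open import Relation.Binary.Structures using (IsTotalOrder)
open import Function.Bundles using (_⇔_; mk⇔)
import Algebra.Properties.Ring as RingProperties
import Algebra.Properties.Semiring.Sum as SemiringSum
import Relation.Binary.Reasoning.Setoid as SetoidReasoning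

unsplit⇒⊆⊎⊆∁ : ∀ {n} {S A : Subset n} {s} →
               (∀ {i j} → i ∈ S → j ∈ S → i ∈ A → j ∉ A → ⊥) →
               s ∈ S → S ⊆ A ⊎ S ⊆ ∁ A
unsplit⇒⊆⊎⊆∁ {S = S} {A} {s} unsplit s∈S with s ∈? A
... | yes s∈A = inj₁ λ {i} i∈S → inside i i∈S
  where
  inside : ∀ i → i ∈ S → i ∈ A
  inside i i∈S with i ∈? A
  ... | yes i∈A = i∈A
  ... | no  i∉A = ⊥-elim (unsplit s∈S i∈S s∈A i∉A)
... | no  s∉A = inj₂ λ i∈S → x∉p⇒x∈∁p λ i∈A → unsplit i∈S s∈S i∈A s∉A

module OrderedFieldProperties {c ℓ} (R : CompleteOrderedField c ℓ) where
  open CompleteOrderedField R hiding (zero)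
  open RingProperties ring
  open IsTotalOrder ≤-isTotalOrder using (antisym; total)
    renaming (trans to ≤-trans; reflexive to ≤-reflexive;
              ≲-respˡ-≈ to ≤-respˡ; ≲-respʳ-≈ to ≤-respʳ)
  open SemiringSum semiring using (sum)

  x-y≈x : ∀ x {y} → y ≈ 0# → x - y ≈ x
  x-y≈x x y≈0 = trans (+-congˡ (trans (-‿cong y≈0) -0#≈0#)) (+-identityʳ x)

  x-y≈-y : ∀ {x} y → x ≈ 0# → x - y ≈ - y
  x-y≈-y y x≈0 = trans (+-congʳ x≈0) (+-identityˡ (- y))

  0≤-x⇒x≤0 : ∀ {x} → 0# ≤ᶠ - x → x ≤ᶠ 0#
  0≤-x⇒x≤0 {x} h = ≤-respʳ (-‿inverseˡ x) (≤-respˡ (+-identityˡ x) (+-mono-≤ x h))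

  x≤0⇒0≤-x : ∀ {x} → x ≤ᶠ 0# → 0# ≤ᶠ - x
  x≤0⇒0≤-x {x} h = ≤-respʳ (+-identityˡ (- x)) (≤-respˡ (-‿inverseʳ x) (+-mono-≤ (- x) h))

  0≤x⇒-x≤0 : ∀ {x} → 0# ≤ᶠ x → - x ≤ᶠ 0#
  0≤x⇒-x≤0 {x} h = 0≤-x⇒x≤0 (≤-respʳ (sym (-‿involutive x)) h)

  *-nonneg-nonpos : ∀ {x y} → 0# ≤ᶠ x → y ≤ᶠ 0# → x * y ≤ᶠ 0#
  *-nonneg-nonpos {x} {y} 0≤x y≤0 =
    0≤-x⇒x≤0 (≤-respʳ (sym (-‿distribʳ-* x y)) (*-nonneg 0≤x (x≤0⇒0≤-x y≤0)))

  0≤1 : 0# ≤ᶠ 1#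
  0≤1 with total 0# 1#
  ... | inj₁ 0≤1 = 0≤1
  ... | inj₂ 1≤0 = ≤-respʳ -1*-1≈1 (*-nonneg (x≤0⇒0≤-x 1≤0) (x≤0⇒0≤-x 1≤0))
    where
    -1*-1≈1 : - 1# * - 1# ≈ 1#
    -1*-1≈1 = trans (-1*x≈-x (- 1#)) (-‿involutive 1#)

  inverse-nonneg : ∀ {x y} → 0# ≤ᶠ x → x * y ≈ 1# → 0# ≤ᶠ y
  inverse-nonneg {x} {y} 0≤x xy≈1 with total 0# y
  ... | inj₁ 0≤y = 0≤y
  ... | inj₂ y≤0 = ⊥-elim (0≉1 (antisym 0≤1 (≤-respˡ xy≈1 (*-nonneg-nonpos 0≤x y≤0))))

  scaled-opposite-signs : ∀ {t x y} → 0# ≤ᶠ x → y ≤ᶠ 0# →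
    0# ≤ᶠ t * x → 0# ≤ᶠ t * y → t * x ≈ 0# ⊎ t * y ≈ 0#
  scaled-opposite-signs {t} {x} {y} 0≤x y≤0 0≤tx 0≤ty with total 0# t
  ... | inj₁ 0≤t = inj₂ (antisym (*-nonneg-nonpos 0≤t y≤0) 0≤ty)
  ... | inj₂ t≤0 = inj₁ (antisym (≤-respˡ (*-comm x t) (*-nonneg-nonpos 0≤x t≤0)) 0≤tx)

  +-nonneg : ∀ {x y} → 0# ≤ᶠ x → 0# ≤ᶠ y → 0# ≤ᶠ x + y
  +-nonneg {x} {y} 0≤x 0≤y =
    ≤-trans 0≤x (≤-respʳ (+-comm y x) (≤-respˡ (+-identityˡ x) (+-mono-≤ x 0≤y)))

  nonneg-+≈0 : ∀ {x y} → 0# ≤ᶠ x → 0# ≤ᶠ y → x + y ≈ 0# → x ≈ 0#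
  nonneg-+≈0 {x} {y} 0≤x 0≤y x+y≈0 =
    antisym (≤-respʳ (trans (+-comm y x) x+y≈0) (≤-respˡ (+-identityˡ x) (+-mono-≤ x 0≤y))) 0≤x

  sum-nonneg : ∀ {n} {f : Fin n → Carrier} → (∀ i → 0# ≤ᶠ f i) → 0# ≤ᶠ sum f
  sum-nonneg {zero}  0≤f = ≤-reflexive refl
  sum-nonneg {suc n} 0≤f = +-nonneg (0≤f zero) (sum-nonneg (λ i → 0≤f (suc i)))

  sum-nonneg-≈0 : ∀ {n} {f : Fin n → Carrier} → (∀ i → 0# ≤ᶠ f i) → sum f ≈ 0# →
                  ∀ i → f i ≈ 0#
  sum-nonneg-≈0 {suc n} 0≤f ∑f≈0 zero =
    nonneg-+≈0 (0≤f zero) (sum-nonneg (λ i → 0≤f (suc i))) ∑f≈0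
  sum-nonneg-≈0 {suc n} 0≤f ∑f≈0 (suc i) =
    sum-nonneg-≈0 (λ j → 0≤f (suc j))
      (nonneg-+≈0 (sum-nonneg (λ j → 0≤f (suc j))) (0≤f zero) (trans (+-comm _ _) ∑f≈0)) i

module AffineDependence {c ℓ} (R : CompleteOrderedField c ℓ) {d m : ℕ} (p : Fin m → Point R d) where
  open CompleteOrderedField R hiding (zero)
  open RingProperties ring
  open OrderedFieldProperties R
  open IsTotalOrder ≤-isTotalOrder using () renaming (refl to ≤-refl)
  open SemiringSum semiring using (sum; sum-cong-≋; ∑-distrib-+; *-distribˡ-sum)
  open SetoidReasoning setoid

  sumF≈sum : ∀ {n} (f : Fin n → Carrier) → sumF R f ≈ sum f
  sumF≈sum {zero}  f = refl
  sumF≈sum {suc n} f = +-congˡ (sumF≈sum (λ i → f (suc i)))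

  sum-neg : ∀ {n} (f : Fin n → Carrier) → sum (λ i → - f i) ≈ - sum f
  sum-neg {zero}  f = sym -0#≈0#
  sum-neg {suc n} f = trans (+-congˡ (sum-neg (λ i → f (suc i)))) (-‿+-comm _ _)

  homogeneous : ∀ {n} → Point R n → Point R (suc n)
  homogeneous x zero    = 1#
  homogeneous x (suc k) = x k

  -- Working with the points (1, pᵢ) makes the mass ∑ uᵢ the 0th coordinate of ∑ uᵢ (1, pᵢ),
  -- so an affine dependence is a single vector equation.
  combination : (Fin m → Carrier) → Point R (suc d)
  combination u k = sum (λ i → u i * homogeneous (p i) k)

  IsAffineDependence : (Fin m → Carrier) → Set ℓ
  IsAffineDependence u = ∀ k → combination u k ≈ 0#

  combination-mass : ∀ u → combination u zero ≈ sum u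
  combination-mass u = sum-cong-≋ (λ i → *-identityʳ (u i))

  combination-scale : ∀ t u k → combination (λ i → t * u i) k ≈ t * combination u k
  combination-scale t u k =
    trans (sum-cong-≋ (λ i → *-assoc t (u i) _))
          (sym (*-distribˡ-sum t (λ i → u i * homogeneous (p i) k)))

  combination-difference : ∀ f g k →
    combination (λ i → f i - g i) k ≈ combination f k - combination g k
  combination-difference f g k = begin
    sum (λ i → (f i - g i) * q i)           ≈⟨ sum-cong-≋ (λ i → [y-z]x≈yx-zx (q i) (f i) (g i)) ⟩
    sum (λ i → f i * q i - g i * q i)       ≈⟨ ∑-distrib-+ (λ i → f i * q i) (λ i → - (g i * q i)) ⟩
    sum (λ i → f i * q i) + sum (λ i → - (g i * q i))
                                            ≈⟨ +-congˡ (sum-neg (λ i → g i * q i)) ⟩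
    combination f k - combination g k       ∎
    where
    q : Fin m → Carrier
    q i = homogeneous (p i) k

  restrict : Subset m → (Fin m → Carrier) → Fin m → Carrier
  restrict P u i with i ∈? P
  ... | yes _ = u i
  ... | no  _ = 0#

  restrict-∈ : ∀ {P} u {i} → i ∈ P → restrict P u i ≈ u i
  restrict-∈ {P} u {i} i∈P with i ∈? P
  ... | yes _   = refl
  ... | no  i∉P = ⊥-elim (i∉P i∈P)

  restrict-∉ : ∀ {P} u {i} → i ∉ P → restrict P u i ≈ 0#
  restrict-∉ {P} u {i} i∉P with i ∈? P
  ... | yes i∈P = ⊥-elim (i∉P i∈P)
  ... | no  _   = refl

  restrict-nonneg : ∀ {P u} → (∀ {i} → i ∈ P → 0# ≤ᶠ u i) → ∀ i → 0# ≤ᶠ restrict P u i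
  restrict-nonneg {P} {u} 0≤u i with i ∈? P
  ... | yes i∈P = 0≤u i∈P
  ... | no  _   = ≤-refl

  restrict-+-∁ : ∀ P u i → restrict P u i + restrict (∁ P) u i ≈ u i
  restrict-+-∁ P u i with i ∈? P
  ... | yes i∈P = trans (+-congˡ (restrict-∉ u (x∈p⇒x∉∁p i∈P))) (+-identityʳ (u i))
  ... | no  i∉P = trans (+-identityˡ _) (restrict-∈ u (x∉p⇒x∈∁p i∉P))

  combination-restrict-+-∁ : ∀ P u k →
    combination (restrict P u) k + combination (restrict (∁ P) u) k ≈ combination u k
  combination-restrict-+-∁ P u k =
    trans (sym (∑-distrib-+ (λ i → restrict P u i * q i) (λ i → restrict (∁ P) u i * q i)))
          (sum-cong-≋ (λ i → trans (sym (distribʳ _ _ _)) (*-congʳ (restrict-+-∁ P u i))))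
    where
    q : Fin m → Carrier
    q i = homogeneous (p i) k

  dependence-difference : ∀ f g → (∀ k → combination f k ≈ combination g k) →
    IsAffineDependence (λ i → f i - g i)
  dependence-difference f g f≈g k = trans (combination-difference f g k) (x≈y⇒x∙y⁻¹≈ε (f≈g k))

  dependence-scale : ∀ t u → IsAffineDependence u → IsAffineDependence (λ i → t * u i)
  dependence-scale t u dep k = trans (combination-scale t u k) (trans (*-congˡ (dep k)) (zeroʳ t))

  affine⇒homogeneous : ∀ {w : Fin m → Carrier} {x : Point R d} →
    sumF R w ≈ 1# → (∀ k → sumF R (λ i → w i * p i k) ≈ x k) →
    ∀ k → combination w k ≈ homogeneous x k
  affine⇒homogeneous {w} sw≈1 wp≈x zero    = trans (combination-mass w) (trans (sym (sumF≈sum w)) sw≈1)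
  affine⇒homogeneous {w} sw≈1 wp≈x (suc k) = trans (sym (sumF≈sum (λ i → w i * p i k))) (wp≈x k)

  homogeneous⇒affine : ∀ {w : Fin m → Carrier} {x : Point R d} →
    (∀ k → combination w k ≈ homogeneous x k) →
    sumF R w ≈ 1# × (∀ k → sumF R (λ i → w i * p i k) ≈ x k)
  homogeneous⇒affine {w} w≈x =
    trans (sumF≈sum w) (trans (sym (combination-mass w)) (w≈x zero)) ,
    λ k → trans (sumF≈sum (λ i → w i * p i k)) (w≈x (suc k))

  common-point-dependence : ∀ (w v : Fin m → Carrier) {x : Point R d} →
    sumF R w ≈ 1# → (∀ k → sumF R (λ i → w i * p i k) ≈ x k) →
    sumF R v ≈ 1# → (∀ k → sumF R (λ i → v i * p i k) ≈ x k) →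
    IsAffineDependence (λ i → w i - v i)
  common-point-dependence w v sw≈1 wp≈x sv≈1 vp≈x =
    dependence-difference w v λ k →
      trans (affine⇒homogeneous sw≈1 wp≈x k) (sym (affine⇒homogeneous sv≈1 vp≈x k))

  nonneg-dependence⇒conv-meets-aff : ∀ u {S s} → IsAffineDependence u →
    (∀ {i} → i ∈ S → 0# ≤ᶠ u i) → s ∈ S → ¬ u s ≈ 0# → ConvMeetsAff R p S (∁ S)
  nonneg-dependence⇒conv-meets-aff u {S} {s} dep 0≤u s∈S us≉0 =
    x , (w , 0≤w , w-off , w-affine) , (v , v-off , homogeneous⇒affine v≈x)
    where
    σ : Carrier
    σ = sum (restrict S u)

    σ≉0 : ¬ σ ≈ 0#
    σ≉0 σ≈0 = us≉0 (trans (sym (restrict-∈ u s∈S)) (sum-nonneg-≈0 (restrict-nonneg 0≤u) σ≈0 s))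

    y : Carrier
    y = proj₁ (inverse σ σ≉0)

    σy≈1 : σ * y ≈ 1#
    σy≈1 = proj₂ (inverse σ σ≉0)

    w v : Fin m → Carrier
    w i = y * restrict S u i
    v i = - y * restrict (∁ S) u i

    x : Point R d
    x k = combination w (suc k)

    0≤w : ∀ i → 0# ≤ᶠ w i
    0≤w i = *-nonneg (inverse-nonneg (sum-nonneg (restrict-nonneg 0≤u)) σy≈1)
                     (restrict-nonneg 0≤u i)

    w-off : ∀ i → i ∉ S → w i ≈ 0#
    w-off i i∉S = trans (*-congˡ (restrict-∉ u i∉S)) (zeroʳ y)

    v-off : ∀ i → i ∉ ∁ S → v i ≈ 0#
    v-off i i∉∁S = trans (*-congˡ (restrict-∉ u i∉∁S)) (zeroʳ (- y))

    w≈x : ∀ k → combination w k ≈ homogeneous x k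
    w≈x zero    = begin
      combination w zero  ≈⟨ combination-mass w ⟩
      sum w               ≈⟨ sym (*-distribˡ-sum y (restrict S u)) ⟩
      y * σ               ≈⟨ *-comm y σ ⟩
      σ * y               ≈⟨ σy≈1 ⟩
      1#                  ∎
    w≈x (suc k) = refl

    w-affine : sumF R w ≈ 1# × (∀ k → sumF R (λ i → w i * p i k) ≈ x k)
    w-affine = homogeneous⇒affine w≈x

    v≈x : ∀ k → combination v k ≈ homogeneous x k
    v≈x k = begin
      combination v k  ≈⟨ combination-scale (- y) (restrict (∁ S) u) k ⟩
      - y * T          ≈⟨ sym (-‿distribˡ-* y T) ⟩
      - (y * T)        ≈⟨ -‿distribʳ-* y T ⟩
      y * - T          ≈⟨ *-congˡ (sym (+-inverseˡ-unique P T P+T≈0)) ⟩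
      y * P            ≈⟨ sym (combination-scale y (restrict S u) k) ⟩
      combination w k  ≈⟨ w≈x k ⟩
      homogeneous x k  ∎
      where
      P T : Carrier
      P = combination (restrict S u) k
      T = combination (restrict (∁ S) u) k
      P+T≈0 : P + T ≈ 0#
      P+T≈0 = trans (combination-restrict-+-∁ S u k) (dep k)

module GeneralPositionProperties {c ℓ} (R : CompleteOrderedField c ℓ) {d}
  (p : Fin (suc (suc d)) → Point R d) (gp : GeneralPosition R p) where
  open CompleteOrderedField R hiding (zero)
  open RingProperties ring
  open IsTotalOrder ≤-isTotalOrder using () renaming (≲-respˡ-≈ to ≤-respˡ; ≲-respʳ-≈ to ≤-respʳ)
  open OrderedFieldProperties R
  open AffineDependence R p
  open SemiringSum semiring using (sum-cong-≋; sum-replicate-zero)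

  ∣∁⁅j⁆∣≤1+d : ∀ j → ∣ ∁ ⁅ j ⁆ ∣ ≤ℕ suc d
  ∣∁⁅j⁆∣≤1+d j =
    ℕₚ.≤-reflexive (≡.trans (∣∁p∣≡n∸∣p∣ ⁅ j ⁆) (≡.cong (suc (suc d) ∸_) (∣⁅x⁆∣≡1 j)))

  dependence-vanishing-at-a-point : ∀ u {j} → IsAffineDependence u → u j ≈ 0# → ∀ i → u i ≈ 0#
  dependence-vanishing-at-a-point u {j} dep uj≈0 =
    gp (∁ ⁅ j ⁆) (∣∁⁅j⁆∣≤1+d j) u vanishes-off
       (trans (sumF≈sum u) (trans (sym (combination-mass u)) (dep zero)))
       (λ k → trans (sumF≈sum (λ i → u i * p i k)) (dep (suc k)))
    where
    vanishes-off : ∀ i → i ∉ ∁ ⁅ j ⁆ → u i ≈ 0#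
    vanishes-off i i∉∁⁅j⁆ =
      ≡.subst (λ l → u l ≈ 0#) (≡.sym (x∈⁅y⁆⇒x≡y j (x∉∁p⇒x∈p i∉∁⁅j⁆))) uj≈0

  dependences-proportional : ∀ μ ν {j} → IsAffineDependence μ → IsAffineDependence ν →
    ¬ μ j ≈ 0# → ∃ λ t → ∀ i → ν i ≈ t * μ i
  dependences-proportional μ ν {j} μ-dep ν-dep μj≉0 =
    t , λ i → x∙y⁻¹≈ε⇒x≈y (ν i) (t * μ i)
                (dependence-vanishing-at-a-point (λ l → ν l - t * μ l) ν-tμ-dep νj-tμj≈0 i)
    where
    μj⁻¹ t : Carrier
    μj⁻¹ = proj₁ (inverse (μ j) μj≉0)
    t = ν j * μj⁻¹

    ν-tμ-dep : IsAffineDependence (λ i → ν i - t * μ i)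
    ν-tμ-dep = dependence-difference ν (λ i → t * μ i) λ k →
      trans (ν-dep k) (sym (dependence-scale t μ μ-dep k))

    νj-tμj≈0 : ν j - t * μ j ≈ 0#
    νj-tμj≈0 = x≈y⇒x∙y⁻¹≈ε (sym (begin
      ν j * μj⁻¹ * μ j    ≈⟨ *-assoc (ν j) μj⁻¹ (μ j) ⟩
      ν j * (μj⁻¹ * μ j)  ≈⟨ *-congˡ (trans (*-comm μj⁻¹ (μ j)) (proj₂ (inverse (μ j) μj≉0))) ⟩
      ν j * 1#            ≈⟨ *-identityʳ (ν j) ⟩
      ν j                 ∎))
      where open SetoidReasoning setoid

  weight-difference-nowhere-zero : ∀ {S} (w v : Fin (suc (suc d)) → Carrier) →
    (∀ i → i ∉ S → w i ≈ 0#) → (∀ i → i ∈ S → v i ≈ 0#) → sumF R w ≈ 1# →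
    IsAffineDependence (λ i → w i - v i) → ∀ j → ¬ w j - v j ≈ 0#
  weight-difference-nowhere-zero {S} w v w-off v-on sw≈1 dep j wj-vj≈0 =
    0≉1 (trans (sym sw≈0) sw≈1)
    where
    w-v≈0 : ∀ i → w i - v i ≈ 0#
    w-v≈0 = dependence-vanishing-at-a-point (λ i → w i - v i) dep wj-vj≈0

    w≈0 : ∀ i → w i ≈ 0#
    w≈0 i with i ∈? S
    ... | yes i∈S = trans (sym (x-y≈x (w i) (v-on i i∈S))) (w-v≈0 i)
    ... | no  i∉S = w-off i i∉S

    sw≈0 : sumF R w ≈ 0#
    sw≈0 = trans (sumF≈sum w) (trans (sum-cong-≋ w≈0) (sum-replicate-zero (suc (suc d))))

  record RadonDependence (A : Subset (suc (suc d))) : Set (c ⊔ ℓ) where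
    field
      μ            : Fin (suc (suc d)) → Carrier
      dependence   : IsAffineDependence μ
      nonneg-on    : ∀ {i} → i ∈ A → 0# ≤ᶠ μ i
      nonpos-off   : ∀ {i} → i ∉ A → μ i ≤ᶠ 0#
      nowhere-zero : ∀ i → ¬ μ i ≈ 0#
  open RadonDependence

  radon-dependence : ∀ {A} → ConvMeetsConv R p A (∁ A) → RadonDependence A
  radon-dependence {A} (x , (a , 0≤a , a-off , sa≈1 , ap≈x) , (b , 0≤b , b-off , sb≈1 , bp≈x)) = record
    { μ            = λ i → a i - b i
    ; dependence   = a-b-dep
    ; nonneg-on    = λ {i} i∈A → ≤-respʳ (sym (x-y≈x (a i) (b-on i i∈A))) (0≤a i)
    ; nonpos-off   = λ {i} i∉A → ≤-respˡ (sym (x-y≈-y (b i) (a-off i i∉A))) (0≤x⇒-x≤0 (0≤b i))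
    ; nowhere-zero = weight-difference-nowhere-zero a b a-off b-on sa≈1 a-b-dep
    }
    where
    b-on : ∀ i → i ∈ A → b i ≈ 0#
    b-on i i∈A = b-off i (x∈p⇒x∉∁p i∈A)

    a-b-dep : IsAffineDependence (λ i → a i - b i)
    a-b-dep = common-point-dependence a b sa≈1 ap≈x sb≈1 bp≈x

  complement : ∀ {A} → RadonDependence A → RadonDependence (∁ A)
  complement rd = record
    { μ            = λ i → - 1# * μ rd i
    ; dependence   = dependence-scale (- 1#) (μ rd) (dependence rd)
    ; nonneg-on    = λ {i} i∈∁A →
        ≤-respʳ (sym (-1*x≈-x (μ rd i))) (x≤0⇒0≤-x (nonpos-off rd (x∈∁p⇒x∉p i∈∁A)))
    ; nonpos-off   = λ {i} i∉∁A →
        ≤-respˡ (sym (-1*x≈-x (μ rd i))) (0≤x⇒-x≤0 (nonneg-on rd (x∉∁p⇒x∈p i∉∁A)))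
    ; nowhere-zero = λ i -μi≈0 → nowhere-zero rd i
        (-‿injective (trans (sym (-1*x≈-x (μ rd i))) (trans -μi≈0 (sym -0#≈0#))))
    }

  conv-meets-aff⇒nonneg-dependence : ∀ {S} → ConvMeetsAff R p S (∁ S) →
    ∃ λ ν → IsAffineDependence ν × (∀ {i} → i ∈ S → 0# ≤ᶠ ν i) × (∀ i → ¬ ν i ≈ 0#)
  conv-meets-aff⇒nonneg-dependence {S}
    (x , (w , 0≤w , w-off , sw≈1 , wp≈x) , (v , v-off , sv≈1 , vp≈x)) =
    (λ i → w i - v i) , w-v-dep ,
    (λ {i} i∈S → ≤-respʳ (sym (x-y≈x (w i) (v-on i i∈S))) (0≤w i)) ,
    weight-difference-nowhere-zero w v w-off v-on sw≈1 w-v-dep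
    where
    v-on : ∀ i → i ∈ S → v i ≈ 0#
    v-on i i∈S = v-off i (x∈p⇒x∉∁p i∈S)

    w-v-dep : IsAffineDependence (λ i → w i - v i)
    w-v-dep = common-point-dependence w v sw≈1 wp≈x sv≈1 vp≈x

  conv-meets-aff⇒unsplit : ∀ {A S} → RadonDependence A → ConvMeetsAff R p S (∁ S) →
    ∀ {i j} → i ∈ S → j ∈ S → i ∈ A → j ∉ A → ⊥
  conv-meets-aff⇒unsplit rd SmeetsS∁ {i} {j} i∈S j∈S i∈A j∉A
    with conv-meets-aff⇒nonneg-dependence SmeetsS∁
  ... | ν , ν-dep , 0≤ν , ν≉0
    with dependences-proportional (μ rd) ν (dependence rd) ν-dep (nowhere-zero rd i)
  ... | t , ν≈tμ
    with scaled-opposite-signs (nonneg-on rd i∈A) (nonpos-off rd j∉A)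
           (≤-respʳ (ν≈tμ i) (0≤ν i∈S)) (≤-respʳ (ν≈tμ j) (0≤ν j∈S))
  ... | inj₁ tμi≈0 = ν≉0 i (trans (ν≈tμ i) tμi≈0)
  ... | inj₂ tμj≈0 = ν≉0 j (trans (ν≈tμ j) tμj≈0)

  ⊆-side⇒conv-meets-aff : ∀ {A S s} → RadonDependence A → S ⊆ A → s ∈ S →
    ConvMeetsAff R p S (∁ S)
  ⊆-side⇒conv-meets-aff {s = s} rd S⊆A s∈S =
    nonneg-dependence⇒conv-meets-aff (μ rd) (dependence rd) (λ i∈S → nonneg-on rd (S⊆A i∈S))
      s∈S (nowhere-zero rd s)

open import Data.Nat using (_+_)

proposition2 : ∀ {c ℓ} (R : CompleteOrderedField c ℓ) (d : ℕ)
    (p : Fin (2 + d) → Point R d) (S : Subset (2 + d)) →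
    Distinct R p → GeneralPosition R p →
    Nonempty S → Nonempty (∁ S) →
    (A : Subset (2 + d)) → ConvMeetsConv R p A (∁ A) →
    ConvMeetsAff R p S (∁ S) ⇔ (S ⊆ A ⊎ S ⊆ ∁ A)
proposition2 R d p S _ gp (s , s∈S) _ A AmeetsA∁ = mk⇔
  (λ SmeetsS∁ → unsplit⇒⊆⊎⊆∁ (conv-meets-aff⇒unsplit radon SmeetsS∁) s∈S)
  λ { (inj₁ S⊆A)  → ⊆-side⇒conv-meets-aff radon S⊆A s∈S
    ; (inj₂ S⊆∁A) → ⊆-side⇒conv-meets-aff (complement radon) S⊆∁A s∈S
    }
  where
  open GeneralPositionProperties R p gp
  radon : RadonDependence A
  radon = radon-dependence AmeetsA∁
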